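{- Let $H$ be a positive integer, $s\ge H+1$, $G$ a triangle-free $T$-regular graph, and $1\le k<H$. For any two edges $e_i\neq e_j$ of $G$, the restriction chains $R_{o,e_i}$ and $R_{o,e_j}$ of the split chain $\widetilde{\mathcal{Q}}^{\downarrow\uparrow}_k$ (defined in the context) are isomorphic Markov chains.
   Context: $\mathcal{Q}$ is the simplicial complex with vertex set $V(G)\times[s]$ whose faces are all subsets of sets $\{(v_1,b_1),\dots,(v_{H+1},b_{H+1})\}$ with $b_1,\dots,b_{H+1}\in[s]$ distinct and $v_1,\dots,v_{H+1}\in\{a,c\}$ for some edge $\{a,c\}\in E(G)$. A $k$-face has $k+1$ elements; each $k$-face is uniquely written $(F,f)=\{(f(b),b):b\in F\}$ with $F\subseteq[s]$, $|F|=k+1$, $f:F\to V(G)$ whose image is a single vertex or the two endpoints of an edge. $(F,f)$ is $0$-offset if $f$ is constant. Weights: $w(J)=1$ for $H$-faces; for a $k$-face $F$ with $k<H$, $w(F)=\sum_J w(J)$ over $(k+1)$-faces $J\supseteq F$. The down-up walk $\mathcal{Q}^{\downarrow\uparrow}_k$: from $F$, remove a uniformly random $x\in F$, then move to a $k$-face $J\supseteq F\setminus\{x\}$ with probability $w(J)/w(F\setminus\{x\})$. The split chain $\widetilde{\mathcal{Q}}^{\downarrow\uparrow}_k$ has states $(F,f,c)$: for each $0$-offset $(F,f)$ with image $\{u\}$, the $T$ states $(F,f,\{u,v\})$, $v$ a neighbor of $u$; for every other $(F,f)$, the state $(F,f,\mathrm{image}(f))$. Transition probability $P$ from $(F,f,c)$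 to $(F',f',c')$ is $\mathcal{Q}^{\downarrow\uparrow}_k[(F,f)\to(F',f')]/T$ if $(F',f')$ is $0$-offset and $\mathcal{Q}^{\downarrow\uparrow}_k[(F,f)\to(F',f')]$ otherwise. For an edge $e$ of $G$, let $\Omega_e=\{(F,f,c): c=e\}$. The restriction chain $R_{o,e}$ has state space $\Omega_e$ and transitions $R_{o,e}(x,y)=P(x,y)$ for $x\ne y$ in $\Omega_e$ and $R_{o,e}(x,x)=1-\sum_{z\in\Omega_e\setminus\{x\}}P(x,z)$. -}

module Defs where

open import Data.Bool using (Bool; true; false; _∧_; _∨_; not; if_then_else_; T)
open import Data.Nat using (ℕ; zero; suc; _+_; _∸_; _≤ᵇ_; _≡ᵇ_)
open import Data.Fin using (Fin)
import Data.Fin.Properties as FinP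
open import Data.Maybe using (Maybe; just; nothing; is-just)
import Data.Maybe.Properties as MaybeP
open import Data.List using (List; []; _∷_; map; concatMap; filterᵇ; allFin; length; foldr; catMaybes)
open import Data.Bool.ListAction using (all; any)
open import Data.Nat.ListAction using (sum)
open import Data.Vec using (Vec; []; _∷_; toList; lookup; _[_]≔_)
import Data.Vec.Properties as VecP
open import Data.Integer using (+_)
open import Data.Rational using (ℚ; 0ℚ; 1ℚ; _/_) renaming (_+_ to _+ℚ_; _*_ to _*ℚ_; _-_ to _-ℚ_)
open import Data.Product using (Σ; _,_; proj₁)
open import Relation.Nullary using (does)
open import Relation.Binary.PropositionalEquality using (_≡_)
open import Function.Bundles using (_↔_; Inverse)

SimpleGraph : {n : ℕ} → (Fin n → Fin n → Bool) → Set
SimpleGraph {n} adj = ((u v : Fin n) → adj u v ≡ adj v u) Σ.× ((v : Fin n) → adj v v ≡ false)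
  where import Data.Product as Σ

count : {A : Set} → (A → Bool) → List A → ℕ
count p xs = length (filterᵇ p xs)

Regular : {n : ℕ} → ℕ → (Fin n → Fin n → Bool) → Set
Regular {n} deg adj = (v : Fin n) → count (adj v) (allFin n) ≡ deg

TriangleFree : {n : ℕ} → (Fin n → Fin n → Bool) → Set
TriangleFree {n} adj = (a b c : Fin n) → adj a b ≡ true → adj b c ≡ true → adj a c ≡ true → ⊥
  where open import Data.Empty using (⊥)

-- Sums of rationals and a total division of naturals (only ever used
-- with nonzero denominators)

sumℚ : List ℚ → ℚ
sumℚ = foldr _+ℚ_ 0ℚ

_÷ℕ_ : ℕ → ℕ → ℚ
p ÷ℕ zero = 0ℚ
p ÷ℕ suc q = (+ p) / suc q

-- A subset of V(G) × [s] in which each b ∈ [s] occurs at most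
-- once is encoded as g : Vec (Maybe (Fin n)) s, with g[b] = just v meaning
-- (v , b) ∈ the set, i.e. F = {b | g[b] ≠ nothing} and f(b) = v.

module Chain (n s H k deg : ℕ) (adj : Fin n → Fin n → Bool) where

  Cfg : Set
  Cfg = Vec (Maybe (Fin n)) s

  eqF : Fin n → Fin n → Bool
  eqF x y = does (x FinP.≟ y)

  eqV : Cfg → Cfg → Bool
  eqV g h = does (VecP.≡-dec (MaybeP.≡-dec FinP._≟_) g h)

  allCfgs : (m : ℕ) → List (Vec (Maybe (Fin n)) m)
  allCfgs zero = [] ∷ []
  allCfgs (suc m) = concatMap (λ x → map (x ∷_) (allCfgs m)) (nothing ∷ map just (allFin n))

  cfgs : List Cfg
  cfgs = allCfgs s

  positions : List (Fin s)
  positions = allFin s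

  -- the values f(b), b ∈ F (the image of f, with repetitions)
  vals : Cfg → List (Fin n)
  vals g = catMaybes (toList g)

  size : Cfg → ℕ
  size g = length (vals g)

  inEdge : Fin n → Fin n → Fin n → Bool
  inEdge a c v = eqF v a ∨ eqF v c

  isFace : Cfg → Bool
  isFace g = (size g ≤ᵇ suc H) ∧
    any (λ a → any (λ c → adj a c ∧ all (inEdge a c) (vals g)) (allFin n)) (allFin n)

  isKFace : Cfg → Bool
  isKFace g = isFace g ∧ (size g ≡ᵇ suc k)

  agree : Maybe (Fin n) → Maybe (Fin n) → Bool
  agree nothing _ = true
  agree (just v) nothing = false
  agree (just v) (just u) = eqF v u

  sub : Cfg → Cfg → Bool
  sub g h = all (λ b → agree (lookup g b) (lookup h b)) positions

  -- weights: wt m g is the weight of a face g of dimension H - m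
  wt : ℕ → Cfg → ℕ
  wt zero g = 1
  wt (suc m) g = sum (map (wt m)
    (filterᵇ (λ J → isFace J ∧ (size J ≡ᵇ suc (size g)) ∧ sub g J) cfgs))

  w : Cfg → ℕ
  w g = wt (suc H ∸ size g) g

  remove : Cfg → Fin s → Cfg
  remove g b = g [ b ]≔ nothing

  Q : Cfg → Cfg → ℚ
  Q g g' = sumℚ (map (λ b →
    if is-just (lookup g b) ∧ sub (remove g b) g'
    then (1 ÷ℕ suc k) *ℚ (w g' ÷ℕ w (remove g b))
    else 0ℚ) positions)

  zeroOffset : Cfg → Bool
  zeroOffset g with vals g
  ... | [] = true
  ... | u ∷ us = all (eqF u) us

  P : Cfg → Cfg → ℚ
  P g g' = if zeroOffset g' then Q g g' *ℚ (1 ÷ℕ deg) else Q g g'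

  validLabel : Cfg → Fin n → Fin n → Bool
  validLabel g a c with zeroOffset g | vals g
  ... | true  | [] = false
  ... | true  | u ∷ _ = adj a c ∧ inEdge a c u
  ... | false | vs = adj a c ∧ all (inEdge a c) vs ∧ any (eqF a) vs ∧ any (eqF c) vs

  inΩ : Fin n → Fin n → Cfg → Bool
  inΩ a c g = isKFace g ∧ validLabel g a c

  Ω : Fin n → Fin n → Set
  Ω a c = Σ Cfg (λ g → T (inΩ a c g))

  R : (a c : Fin n) → Ω a c → Ω a c → ℚ
  R a c (g , _) (g' , _) =
    if eqV g g'
    then 1ℚ -ℚ sumℚ (map (P g) (filterᵇ (λ z → inΩ a c z ∧ not (eqV g z)) cfgs))
    else P g g'

record MarkovIso {A B : Set} (R₁ : A → A → ℚ) (R₂ : B → B → ℚ) : Set where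
  field
    bij : A ↔ B
    preserves : (x y : A) → R₂ (Inverse.to bij x) (Inverse.to bij y) ≡ R₁ x y

module Submission where

-- Let {a,c} and {a',c'} be edges and σ a permutation of V(G) with
-- σa = a', σc = c'.  Relabelling every pair (v,b) of a configuration by σ
-- maps Ω_{ac} bijectively onto Ω_{a'c'}; we show it preserves all
-- transition probabilities.  σ is not a graph automorphism, so the delicate
-- point is the face weights w(h) of the faces h ⊆ {a,c} × [s] met by the
-- walk.  A weight only depends on the faces containing h, and
--   * if h uses both a and c, these faces are the subsets of {a,c} × [s];
--   * if h uses only a, they are the faces on the edges {a,y}, y ~ a, and
--     σ may be replaced on h by a permutation ψ that is a local isomorphism
--     at a (ψa = σa and y ~ a ⇔ ψy ~ ψa), which exists by T-regularity;
--   * symmetrically for c, and trivially for h = ∅.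
-- In each case some permutation agreeing with σ on h preserves every face
-- above h, hence the weight of h.  Everything else in the chain (k-faces,
-- labels, 0-offsetness, containment) is invariant under any permutation.

open import Defs
open import Data.Bool using (Bool; true)
open import Data.Nat using (ℕ; suc; _+_; _≤_; _<_)
open import Data.Fin using (Fin)
open import Data.Product using (_×_)
open import Data.Sum using (_⊎_)
open import Relation.Nullary using (¬_)
open import Relation.Binary.PropositionalEquality using (_≡_)

open import Data.Bool using (false; _∧_; _∨_; not; if_then_else_; T)
open import Data.Bool.Properties using (∧-zeroʳ; T-irrelevant; T-∧; T-∨; T-≡)
open import Data.Bool.ListAction using (all; any; and; or)
open import Data.Nat using (zero; _∸_; _≤ᵇ_; _≡ᵇ_)
open import Data.Nat.Properties using (suc-injective)
open import Data.Nat.ListAction using (sum)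
open import Data.Nat.ListAction.Properties using (sum-↭)
open import Data.Fin.Properties using (_≟_)
open import Data.Fin.Permutation using (Permutation′; _⟨$⟩ʳ_; _⟨$⟩ˡ_; inverseˡ; inverseʳ; transpose; _∘ₚ_) renaming (id to idₚ)
open import Data.Maybe using (Maybe; just; nothing; is-just)
import Data.Maybe as Maybe
import Data.Maybe.Properties as MaybeP
open import Data.List using (List; []; _∷_; map; filterᵇ; concatMap; length; allFin; catMaybes)
import Data.List.Properties as ListP
open import Data.List.Membership.Propositional using (_∈_; lose)
open import Data.List.Membership.Propositional.Properties using (∈-allFin; ∈-map⁺; ∈-filter⁺; ∈-filter⁻)
open import Data.List.Membership.Propositional.Properties.WithK using (unique∧set⇒bag)
open import Data.List.Relation.Binary.BagAndSetEquality using (bag; _∼[_]_; ∼bag⇒↭; ↭⇒∼bag; >>=-cong)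
import Data.List.Relation.Binary.BagAndSetEquality as Bag
open import Data.List.Relation.Binary.Permutation.Propositional using (_↭_; ↭-refl; ↭-sym; ↭⇒↭ₛ)
import Data.List.Relation.Binary.Permutation.Propositional.Properties as PermP
open import Data.List.Relation.Binary.Permutation.Setoid.Properties using (foldr-commMonoid)
open import Data.List.Relation.Binary.Pointwise using (Pointwise; []; _∷_)
open import Data.List.Relation.Unary.All using (All; []; _∷_)
import Data.List.Relation.Unary.All as All
import Data.List.Relation.Unary.All.Properties as AllP
open import Data.List.Relation.Unary.Any using (here; there; satisfied)
import Data.List.Relation.Unary.Any.Properties as AnyP
open import Data.List.Relation.Unary.AllPairs using (_∷_; [])
open import Data.List.Relation.Unary.Unique.Propositional using (Unique)
import Data.List.Relation.Unary.Unique.Propositional.Properties as UniqueP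
open import Data.Vec using (Vec; lookup; toList)
import Data.Vec as Vec
import Data.Vec.Properties as VecP
open import Data.Rational using (ℚ; 0ℚ; 1ℚ) renaming (_*_ to _*ℚ_; _-_ to _-ℚ_)
import Data.Rational.Properties as ℚP
open import Data.Product using (Σ; ∃; _,_; proj₁; proj₂)
open import Data.Sum using (inj₁; inj₂)
open import Data.Unit using (tt)
open import Data.Empty using (⊥-elim)
open import Algebra.Bundles using (CommutativeMonoid)
open import Relation.Nullary using (yes; no; does)
open import Relation.Nullary.Decidable using (T?; dec-true; dec-false)
open import Relation.Binary.Definitions using (DecidableEquality)
open import Relation.Binary.PropositionalEquality using (refl; sym; trans; cong; cong₂; subst; subst₂; module ≡-Reasoning)
open import Function using (_∘_; mk↔ₛ′; Equivalence; mk⇔)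

T-ext : {b b' : Bool} → (T b → T b') → (T b' → T b) → b ≡ b'
T-ext {false} {false} _ _ = refl
T-ext {false} {true}  _ g = ⊥-elim (g tt)
T-ext {true}  {false} f _ = ⊥-elim (f tt)
T-ext {true}  {true}  _ _ = refl

does-injective : {A B : Set} (_≟A_ : DecidableEquality A) (_≟B_ : DecidableEquality B)
  (f : A → B) → (∀ {x y} → f x ≡ f y → x ≡ y) →
  ∀ x y → does (f x ≟B f y) ≡ does (x ≟A y)
does-injective _≟A_ _≟B_ f f-inj x y with x ≟A y | f x ≟B f y
... | yes _    | yes _    = refl
... | no _     | no _     = refl
... | yes refl | no fx≢fx = ⊥-elim (fx≢fx refl)
... | no x≢y   | yes fx≡fy = ⊥-elim (x≢y (f-inj fx≡fy))

all-cong : {A : Set} {p q : A → Bool} → (∀ x → p x ≡ q x) → ∀ xs → all p xs ≡ all q xs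
all-cong p≗q xs = cong and (ListP.map-cong p≗q xs)

any-cong : {A : Set} {p q : A → Bool} → (∀ x → p x ≡ q x) → ∀ xs → any p xs ≡ any q xs
any-cong p≗q xs = cong or (ListP.map-cong p≗q xs)

all-map : {A B : Set} (p : B → Bool) (f : A → B) (xs : List A) → all p (map f xs) ≡ all (p ∘ f) xs
all-map p f xs = cong and (sym (ListP.map-∘ xs))

any-map : {A B : Set} (p : B → Bool) (f : A → B) (xs : List A) → any p (map f xs) ≡ any (p ∘ f) xs
any-map p f xs = cong or (sym (ListP.map-∘ xs))

filter-map : {A B : Set} (p : B → Bool) (f : A → B) (xs : List A) →
  filterᵇ p (map f xs) ≡ map f (filterᵇ (p ∘ f) xs)
filter-map p f [] = refl
filter-map p f (x ∷ xs) with p (f x)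
... | true  = cong (f x ∷_) (filter-map p f xs)
... | false = filter-map p f xs

filter-cong : {A : Set} {p q : A → Bool} → (∀ x → p x ≡ q x) → ∀ xs → filterᵇ p xs ≡ filterᵇ q xs
filter-cong {q = q} p≗q [] = refl
filter-cong {q = q} p≗q (x ∷ xs) rewrite p≗q x with q x
... | true  = cong (x ∷_) (filter-cong p≗q xs)
... | false = filter-cong p≗q xs

module _ {A C : Set} (total : List C → C) (total-↭ : ∀ {xs ys} → xs ↭ ys → total xs ≡ total ys)
         {univ : List A} (S : A → A) (S-↭ : map S univ ↭ univ) where

  reindex : (p q : A → Bool) (f g : A → C) →
    (∀ x → q (S x) ≡ p x) → (∀ x → T (p x) → f (S x) ≡ g x) →
    total (map f (filterᵇ q univ)) ≡ total (map g (filterᵇ p univ))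
  reindex p q f g q∘S≡p f∘S≡g = begin
    total (map f (filterᵇ q univ))
      ≡⟨ total-↭ (PermP.map⁺ f (PermP.filter-↭ (T? ∘ q) (↭-sym S-↭))) ⟩
    total (map f (filterᵇ q (map S univ)))
      ≡⟨ cong (total ∘ map f) (filter-map q S univ) ⟩
    total (map f (map S (filterᵇ (q ∘ S) univ)))
      ≡⟨ cong total (sym (ListP.map-∘ (filterᵇ (q ∘ S) univ))) ⟩
    total (map (f ∘ S) (filterᵇ (q ∘ S) univ))
      ≡⟨ cong (total ∘ map (f ∘ S)) (filter-cong q∘S≡p univ) ⟩
    total (map (f ∘ S) (filterᵇ p univ))
      ≡⟨ cong total (ListP.map-cong-local (All.map (f∘S≡g _) (AllP.all-filter (T? ∘ p) univ))) ⟩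
    total (map g (filterᵇ p univ)) ∎
    where open ≡-Reasoning

sumℚ-↭ : {xs ys : List ℚ} → xs ↭ ys → sumℚ xs ≡ sumℚ ys
sumℚ-↭ p = foldr-commMonoid M.setoid M.isCommutativeMonoid (↭⇒↭ₛ p)
  where module M = CommutativeMonoid ℚP.+-0-commutativeMonoid

module _ {n : ℕ} where

  inj : (π : Permutation′ n) {x y : Fin n} → π ⟨$⟩ʳ x ≡ π ⟨$⟩ʳ y → x ≡ y
  inj π {x} {y} πx≡πy = trans (sym (inverseˡ π)) (trans (cong (π ⟨$⟩ˡ_) πx≡πy) (inverseˡ π))

  transpose-left : (i j : Fin n) → transpose i j ⟨$⟩ʳ i ≡ j
  transpose-left i j rewrite dec-true (i ≟ i) refl = refl

  transpose-other : (i j k : Fin n) → ¬ k ≡ i → ¬ k ≡ j → transpose i j ⟨$⟩ʳ k ≡ k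
  transpose-other i j k k≢i k≢j rewrite dec-false (k ≟ i) k≢i | dec-false (k ≟ j) k≢j = refl

  Sends : Permutation′ n → List (Fin n) → List (Fin n) → Set
  Sends π = Pointwise (λ x y → π ⟨$⟩ʳ x ≡ y)

  -- Any two duplicate-free lists of the same length are related by a
  -- permutation: extend recursively and correct the head by a transposition.
  sending : (xs ys : List (Fin n)) → Unique xs → Unique ys → length xs ≡ length ys →
    Σ (Permutation′ n) λ π → Sends π xs ys
  sending [] [] _ _ _ = idₚ , []
  sending (x ∷ xs) (y ∷ ys) (x∉xs ∷ uxs) (y∉ys ∷ uys) eq
    with sending xs ys uxs uys (suc-injective eq)
  ... | π , π-sends = π ∘ₚ transpose (π ⟨$⟩ʳ x) y , transpose-left (π ⟨$⟩ʳ x) y ∷ keep x∉xs y∉ys π-sends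
    where
    keep : ∀ {xs' ys'} → All (λ z → ¬ x ≡ z) xs' → All (λ z → ¬ y ≡ z) ys' →
      Sends π xs' ys' → Sends (π ∘ₚ transpose (π ⟨$⟩ʳ x) y) xs' ys'
    keep [] [] [] = []
    keep (x≢x' ∷ x∉) (y≢y' ∷ y∉) (πx'≡y' ∷ rest) =
      trans (transpose-other (π ⟨$⟩ʳ x) y _ (λ e → x≢x' (sym (inj π e)))
                                         (λ e → y≢y' (trans (sym e) πx'≡y')))
            πx'≡y'
      ∷ keep x∉ y∉ rest

  sends-∈ : ∀ {π xs ys x} → Sends π xs ys → x ∈ xs → π ⟨$⟩ʳ x ∈ ys
  sends-∈ (e ∷ _)    (here refl) = here e
  sends-∈ {π = π} (_ ∷ rest) (there x∈) = there (sends-∈ {π = π} rest x∈)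

  sends-∋ : ∀ {π xs ys y} → Sends π xs ys → y ∈ ys → ∃ λ x → x ∈ xs × π ⟨$⟩ʳ x ≡ y
  sends-∋ (e ∷ _) (here refl) = _ , here refl , e
  sends-∋ {π = π} (_ ∷ rest) (there y∈) with sends-∋ {π = π} rest y∈
  ... | x , x∈ , e = x , there x∈ , e

  permute-allFin : (π : Permutation′ n) → map (π ⟨$⟩ʳ_) (allFin n) ∼[ bag ] allFin n
  permute-allFin π = unique∧set⇒bag (UniqueP.map⁺ (inj π) (UniqueP.allFin⁺ n)) (UniqueP.allFin⁺ n)
    λ {y} → mk⇔ (λ _ → ∈-allFin y)
      (λ _ → subst (_∈ map (π ⟨$⟩ʳ_) (allFin n)) (inverseʳ π) (∈-map⁺ (π ⟨$⟩ʳ_) (∈-allFin (π ⟨$⟩ˡ y))))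

LocalIso : {n : ℕ} → (Fin n → Fin n → Bool) → Permutation′ n → Fin n → Set
LocalIso adj π u = ∀ y → adj (π ⟨$⟩ʳ u) (π ⟨$⟩ʳ y) ≡ adj u y

module _ {n : ℕ} {adj : Fin n → Fin n → Bool} (loopless : ∀ v → adj v v ≡ false) where

  neighbours : Fin n → List (Fin n)
  neighbours u = filterᵇ (adj u) (allFin n)

  neighbour⇒adj : ∀ {u y} → y ∈ neighbours u → T (adj u y)
  neighbour⇒adj {u} y∈N = proj₂ (∈-filter⁻ (T? ∘ adj u) {xs = allFin n} y∈N)

  adj⇒neighbour : ∀ {u y} → T (adj u y) → y ∈ neighbours u
  adj⇒neighbour {u} {y} = ∈-filter⁺ (T? ∘ adj u) (∈-allFin y)

  ¬adj-self : ∀ u → ¬ T (adj u u)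
  ¬adj-self u adj-uu rewrite loopless u = adj-uu

  edge-unique : ∀ {x y} → T (adj x y) → Unique (x ∷ y ∷ [])
  edge-unique {x} adj-xy = ((λ { refl → ¬adj-self x adj-xy }) ∷ []) ∷ [] ∷ []

  closedNeighbourhood-unique : ∀ u → Unique (u ∷ neighbours u)
  closedNeighbourhood-unique u =
    All.tabulate (λ y∈N u≡y → ¬adj-self u (subst (T ∘ adj u) (sym u≡y) (neighbour⇒adj y∈N)))
    ∷ UniqueP.filter⁺ (T? ∘ adj u) (UniqueP.allFin⁺ n)

  -- In a loopless regular graph every vertex u can be sent to any vertex u'
  -- by a local isomorphism at u: both closed neighbourhoods are
  -- duplicate-free lists of length deg + 1.
  localIso : {deg : ℕ} → Regular deg adj → (u u' : Fin n) → Σ (Permutation′ n) λ π → π ⟨$⟩ʳ u ≡ u' × LocalIso adj π u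
  localIso regular u u' with sending (u ∷ neighbours u) (u' ∷ neighbours u')
                     (closedNeighbourhood-unique u) (closedNeighbourhood-unique u')
                     (cong suc (trans (regular u) (sym (regular u'))))
  ... | π , πu≡u' ∷ π-sends = π , πu≡u' , λ y → subst (λ z → adj z (π ⟨$⟩ʳ y) ≡ adj u y) (sym πu≡u')
          (T-ext (to-nbr y) (from-nbr y))
    where
    from-nbr : ∀ y → T (adj u y) → T (adj u' (π ⟨$⟩ʳ y))
    from-nbr y adj-uy = neighbour⇒adj (sends-∈ {π = π} π-sends (adj⇒neighbour adj-uy))

    to-nbr : ∀ y → T (adj u' (π ⟨$⟩ʳ y)) → T (adj u y)
    to-nbr y adj-u'πy with sends-∋ {π = π} π-sends (adj⇒neighbour adj-u'πy)
    ... | x , x∈N , πx≡πy = subst (T ∘ adj u) (inj π πx≡πy) (neighbour⇒adj x∈N)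

module _ {n : ℕ} where

  relabel : {m : ℕ} → (Fin n → Fin n) → Vec (Maybe (Fin n)) m → Vec (Maybe (Fin n)) m
  relabel f = Vec.map (Maybe.map f)

  values : {m : ℕ} → Vec (Maybe (Fin n)) m → List (Fin n)
  values g = catMaybes (toList g)

  values-relabel : ∀ {m} (f : Fin n → Fin n) (g : Vec (Maybe (Fin n)) m) →
    values (relabel f g) ≡ map f (values g)
  values-relabel f Vec.[] = refl
  values-relabel f (nothing Vec.∷ g) = values-relabel f g
  values-relabel f (just v Vec.∷ g) = cong (f v ∷_) (values-relabel f g)

  relabel-local : ∀ {m} {f f' : Fin n → Fin n} (g : Vec (Maybe (Fin n)) m) →
    (∀ {v} → v ∈ values g → f v ≡ f' v) → relabel f g ≡ relabel f' g
  relabel-local Vec.[] _ = refl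
  relabel-local (nothing Vec.∷ g) f≡f' = cong (nothing Vec.∷_) (relabel-local g f≡f')
  relabel-local (just v Vec.∷ g) f≡f' =
    cong₂ Vec._∷_ (cong just (f≡f' (here refl))) (relabel-local g (f≡f' ∘ there))

  relabel-inverse : ∀ {m} {f f' : Fin n → Fin n} → (∀ x → f (f' x) ≡ x) →
    (g : Vec (Maybe (Fin n)) m) → relabel f (relabel f' g) ≡ g
  relabel-inverse ff' Vec.[] = refl
  relabel-inverse ff' (nothing Vec.∷ g) = cong (nothing Vec.∷_) (relabel-inverse ff' g)
  relabel-inverse ff' (just v Vec.∷ g) = cong₂ Vec._∷_ (cong just (ff' v)) (relabel-inverse ff' g)

  lookup⇒values : ∀ {m} (g : Vec (Maybe (Fin n)) m) (b : Fin m) {v} → lookup g b ≡ just v → v ∈ values g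
  lookup⇒values (just _ Vec.∷ g) Fin.zero refl = here refl
  lookup⇒values (nothing Vec.∷ g) (Fin.suc b) e = lookup⇒values g b e
  lookup⇒values (just _ Vec.∷ g) (Fin.suc b) e = there (lookup⇒values g b e)

  values⇒lookup : ∀ {m} (g : Vec (Maybe (Fin n)) m) {v} → v ∈ values g → ∃ λ b → lookup g b ≡ just v
  values⇒lookup (nothing Vec.∷ g) v∈ with values⇒lookup g v∈
  ... | b , e = Fin.suc b , e
  values⇒lookup (just _ Vec.∷ g) (here refl) = Fin.zero , refl
  values⇒lookup (just _ Vec.∷ g) (there v∈) with values⇒lookup g v∈
  ... | b , e = Fin.suc b , e

  erase-lookup : ∀ {m} (g : Vec (Maybe (Fin n)) m) (b b' : Fin m) {v} →
    lookup (g Vec.[ b ]≔ nothing) b' ≡ just v → lookup g b' ≡ just v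
  erase-lookup (_ Vec.∷ g) Fin.zero Fin.zero ()
  erase-lookup (_ Vec.∷ g) Fin.zero (Fin.suc b') e = e
  erase-lookup (_ Vec.∷ g) (Fin.suc b) Fin.zero e = e
  erase-lookup (_ Vec.∷ g) (Fin.suc b) (Fin.suc b') e = erase-lookup g b b' e

module Action (n s H k deg : ℕ) (adj : Fin n → Fin n → Bool) where
  open Chain n s H k deg adj

  infixr 5 _·_
  _·_ : {m : ℕ} → Permutation′ n → Vec (Maybe (Fin n)) m → Vec (Maybe (Fin n)) m
  π · g = relabel (π ⟨$⟩ʳ_) g

  ·-inverse : ∀ {m} (π : Permutation′ n) (g : Vec (Maybe (Fin n)) m) → relabel (π ⟨$⟩ˡ_) (π · g) ≡ g
  ·-inverse π = relabel-inverse (λ _ → inverseˡ π)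

  ·-inverse' : ∀ {m} (π : Permutation′ n) (g : Vec (Maybe (Fin n)) m) → π · relabel (π ⟨$⟩ˡ_) g ≡ g
  ·-inverse' π = relabel-inverse (λ _ → inverseʳ π)

  ·-injective : ∀ {m} (π : Permutation′ n) {g h : Vec (Maybe (Fin n)) m} → π · g ≡ π · h → g ≡ h
  ·-injective π {g} {h} e = trans (sym (·-inverse π g)) (trans (cong (relabel (π ⟨$⟩ˡ_)) e) (·-inverse π h))

  size-· : ∀ π g → size (π · g) ≡ size g
  size-· π g = trans (cong length (values-relabel (π ⟨$⟩ʳ_) g)) (ListP.length-map (π ⟨$⟩ʳ_) (vals g))

  eqF-· : ∀ π x y → eqF (π ⟨$⟩ʳ x) (π ⟨$⟩ʳ y) ≡ eqF x y
  eqF-· π = does-injective _≟_ _≟_ (π ⟨$⟩ʳ_) (inj π)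

  eqV-· : ∀ π g h → eqV (π · g) (π · h) ≡ eqV g h
  eqV-· π = does-injective dec dec (π ·_) (·-injective π)
    where
    dec : DecidableEquality Cfg
    dec = VecP.≡-dec (MaybeP.≡-dec _≟_)

  inEdge-· : ∀ π x y v → inEdge (π ⟨$⟩ʳ x) (π ⟨$⟩ʳ y) (π ⟨$⟩ʳ v) ≡ inEdge x y v
  inEdge-· π x y v = cong₂ _∨_ (eqF-· π v x) (eqF-· π v y)

  agree-· : ∀ π (x y : Maybe (Fin n)) → agree (Maybe.map (π ⟨$⟩ʳ_) x) (Maybe.map (π ⟨$⟩ʳ_) y) ≡ agree x y
  agree-· π nothing y = refl
  agree-· π (just x) nothing = refl
  agree-· π (just x) (just y) = eqF-· π x y

  sub-· : ∀ π g h → sub (π · g) (π · h) ≡ sub g h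
  sub-· π g h = all-cong (λ b → trans (cong₂ agree (VecP.lookup-map b _ g) (VecP.lookup-map b _ h))
                                       (agree-· π (lookup g b) (lookup h b))) positions

  is-just-· : ∀ (π : Permutation′ n) (x : Maybe (Fin n)) → is-just (Maybe.map (π ⟨$⟩ʳ_) x) ≡ is-just x
  is-just-· π nothing  = refl
  is-just-· π (just _) = refl

  remove-· : ∀ π g b → remove (π · g) b ≡ π · remove g b
  remove-· π g b = sym (VecP.map-[]≔ _ g b)

  eqF⇒ : ∀ {x y} → T (eqF x y) → x ≡ y
  eqF⇒ {x} {y} t with x ≟ y
  ... | yes x≡y = x≡y

  ⇒eqF : ∀ {x y} → x ≡ y → T (eqF x y)
  ⇒eqF {x} refl rewrite dec-true (x ≟ x) refl = tt

  inEdge⇒ : ∀ {x y v} → T (inEdge x y v) → v ≡ x ⊎ v ≡ y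
  inEdge⇒ t = Data.Sum.map eqF⇒ eqF⇒ (Equivalence.to T-∨ t)

  ⇒inEdge : ∀ {x y v} → v ≡ x ⊎ v ≡ y → T (inEdge x y v)
  ⇒inEdge v∈xy = Equivalence.from T-∨ (Data.Sum.map ⇒eqF ⇒eqF v∈xy)

  onEdge⇒ : ∀ {x y vs} → T (all (inEdge x y) vs) → ∀ {v} → v ∈ vs → v ≡ x ⊎ v ≡ y
  onEdge⇒ {x} {y} {vs} t v∈ = inEdge⇒ (All.lookup (AllP.all⁺ (inEdge x y) vs t) v∈)

  ⇒onEdge : ∀ {x y vs} → (∀ {v} → v ∈ vs → v ≡ x ⊎ v ≡ y) → T (all (inEdge x y) vs)
  ⇒onEdge {x} {y} on = AllP.all⁻ (inEdge x y) (All.tabulate (⇒inEdge ∘ on))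

  all-inEdge-· : ∀ π x y vs → all (inEdge (π ⟨$⟩ʳ x) (π ⟨$⟩ʳ y)) (map (π ⟨$⟩ʳ_) vs) ≡ all (inEdge x y) vs
  all-inEdge-· π x y vs = trans (all-map _ (π ⟨$⟩ʳ_) vs) (all-cong (inEdge-· π x y) vs)

  sub-lookup : ∀ g h → T (sub g h) → ∀ b {v} → lookup g b ≡ just v → lookup h b ≡ just v
  sub-lookup g h t b {v} gb≡v = agreement (lookup g b) (lookup h b) (All.lookup (AllP.all⁺ _ positions t) (∈-allFin b)) gb≡v
    where
    agreement : ∀ x y → T (agree x y) → x ≡ just v → y ≡ just v
    agreement (just x) (just y) t refl = cong just (sym (eqF⇒ t))

  lookup⇒sub : ∀ g h → (∀ b {v} → lookup g b ≡ just v → lookup h b ≡ just v) → T (sub g h)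
  lookup⇒sub g h g⊆h = AllP.all⁻ _ {xs = positions} (All.tabulate λ {b} _ → agreement (lookup g b) (lookup h b) (g⊆h b))
    where
    agreement : ∀ x y → (∀ {v} → x ≡ just v → y ≡ just v) → T (agree x y)
    agreement nothing y _ = tt
    agreement (just x) y x⊆y rewrite x⊆y refl = ⇒eqF {x} refl

  sub-trans : ∀ g h J → T (sub g h) → T (sub h J) → T (sub g J)
  sub-trans g h J g⊆h h⊆J = lookup⇒sub g J (λ b → sub-lookup h J h⊆J b ∘ sub-lookup g h g⊆h b)

  sub-values : ∀ g h → T (sub g h) → ∀ {v} → v ∈ vals g → v ∈ vals h
  sub-values g h t v∈ with values⇒lookup g v∈
  ... | b , gb≡v = lookup⇒values h b (sub-lookup g h t b gb≡v)

  -- relabelling only reorders the entries nothing, just v of a position,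
  -- hence only reorders the enumeration of all configurations
  ·-allCfgs : (π : Permutation′ n) (m : ℕ) → map (π ·_) (allCfgs m) ∼[ bag ] allCfgs m
  ·-allCfgs π zero = ↭⇒∼bag ↭-refl
  ·-allCfgs π (suc m) = subst (_∼[ bag ] allCfgs (suc m)) (sym regroup)
    (>>=-cong entries-perm (λ x → Bag.map-cong (λ _ → refl) (·-allCfgs π m)))
    where
    entries : List (Maybe (Fin n))
    entries = nothing ∷ map just (allFin n)

    entries-perm : map (Maybe.map (π ⟨$⟩ʳ_)) entries ∼[ bag ] entries
    entries-perm = Bag.∷-cong refl (subst (_∼[ bag ] map just (allFin n))
      (trans (sym (ListP.map-∘ (allFin n))) (ListP.map-∘ (allFin n)))
      (Bag.map-cong (λ _ → refl) (permute-allFin π)))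

    regroup : map (π ·_) (allCfgs (suc m))
            ≡ concatMap (λ x → map (x Vec.∷_) (map (π ·_) (allCfgs m))) (map (Maybe.map (π ⟨$⟩ʳ_)) entries)
    regroup = begin
      map (π ·_) (concatMap (λ x → map (x Vec.∷_) (allCfgs m)) entries)
        ≡⟨ ListP.map-concatMap (π ·_) _ entries ⟩
      concatMap (λ x → map (π ·_) (map (x Vec.∷_) (allCfgs m))) entries
        ≡⟨ ListP.concatMap-cong (λ x → trans (sym (ListP.map-∘ (allCfgs m))) (ListP.map-∘ (allCfgs m))) entries ⟩
      concatMap (λ x → map (Maybe.map (π ⟨$⟩ʳ_) x Vec.∷_) (map (π ·_) (allCfgs m))) entries
        ≡⟨ sym (ListP.concatMap-map _ _ entries) ⟩
      concatMap (λ x → map (x Vec.∷_) (map (π ·_) (allCfgs m))) (map (Maybe.map (π ⟨$⟩ʳ_)) entries) ∎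
      where open ≡-Reasoning

  ·-cfgs : (π : Permutation′ n) → map (π ·_) cfgs ↭ cfgs
  ·-cfgs π = ∼bag⇒↭ (·-allCfgs π s)

-- Write w(h) as a sum over the
-- faces J covering h; relabelling by π preserves the weight of h as soon as
-- π maps faces above h to faces (FacePreserving π h).  This holds when π
-- respects an edge used by h, or is a local isomorphism at a vertex of h.
module Faces (n s H k deg : ℕ) (adj : Fin n → Fin n → Bool) (adj-sym : ∀ u v → adj u v ≡ adj v u)
              (loopless : ∀ v → adj v v ≡ false) where
  open Chain n s H k deg adj
  open Action n s H k deg adj

  onSomeEdge : List (Fin n) → Bool
  onSomeEdge vs = any (λ x → any (λ y → adj x y ∧ all (inEdge x y) vs) (allFin n)) (allFin n)

  onSomeEdge⁻ : ∀ vs → T (onSomeEdge vs) → ∃ λ x → ∃ λ y → T (adj x y) × T (all (inEdge x y) vs)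
  onSomeEdge⁻ vs t with satisfied (AnyP.any⁻ _ (allFin n) t)
  ... | x , tx with satisfied (AnyP.any⁻ _ (allFin n) tx)
  ... | y , txy = x , y , Equivalence.to T-∧ txy

  onSomeEdge⁺ : ∀ {vs} x y → T (adj x y) → T (all (inEdge x y) vs) → T (onSomeEdge vs)
  onSomeEdge⁺ x y adj-xy on = AnyP.any⁺ _ (lose (∈-allFin x) (AnyP.any⁺ _ (lose (∈-allFin y)
    (Equivalence.from T-∧ (adj-xy , on)))))

  onEdgeAt : Fin n → List (Fin n) → Bool
  onEdgeAt u vs = any (λ y → adj u y ∧ all (inEdge u y) vs) (allFin n)

  onEdgeAt⁻ : ∀ u vs → T (onEdgeAt u vs) → ∃ λ y → T (adj u y) × T (all (inEdge u y) vs)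
  onEdgeAt⁻ u vs t with satisfied (AnyP.any⁻ _ (allFin n) t)
  ... | y , ty = y , Equivalence.to T-∧ ty

  onEdgeAt⁺ : ∀ {u vs} y → T (adj u y) → T (all (inEdge u y) vs) → T (onEdgeAt u vs)
  onEdgeAt⁺ y adj-uy on = AnyP.any⁺ _ (lose (∈-allFin y) (Equivalence.from T-∧ (adj-uy , on)))

  onSomeEdge-edge : ∀ {vs x y} → x ∈ vs → y ∈ vs → T (adj x y) → onSomeEdge vs ≡ all (inEdge x y) vs
  onSomeEdge-edge {vs} {x} {y} x∈ y∈ adj-xy = T-ext to (onSomeEdge⁺ {vs} x y adj-xy)
    where
    to : T (onSomeEdge vs) → T (all (inEdge x y) vs)
    to t with onSomeEdge⁻ vs t
    ... | x' , y' , _ , on = ⇒onEdge {x} {y} {vs}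
      (λ v∈ → same (onEdge⇒ {x'} {y'} on x∈) (onEdge⇒ {x'} {y'} on y∈) (onEdge⇒ {x'} {y'} on v∈))
      where
      -- x ≠ y both lie in {x',y'}, so {x',y'} = {x,y}
      x≢y : ¬ x ≡ y
      x≢y refl = ¬adj-self {adj = adj} loopless x adj-xy
      same : ∀ {v} → x ≡ x' ⊎ x ≡ y' → y ≡ x' ⊎ y ≡ y' → v ≡ x' ⊎ v ≡ y' → v ≡ x ⊎ v ≡ y
      same (inj₁ p) (inj₁ q) _        = ⊥-elim (x≢y (trans p (sym q)))
      same (inj₂ p) (inj₂ q) _        = ⊥-elim (x≢y (trans p (sym q)))
      same (inj₁ p) (inj₂ q) (inj₁ r) = inj₁ (trans r (sym p))
      same (inj₁ p) (inj₂ q) (inj₂ r) = inj₂ (trans r (sym q))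
      same (inj₂ p) (inj₁ q) (inj₁ r) = inj₂ (trans r (sym q))
      same (inj₂ p) (inj₁ q) (inj₂ r) = inj₁ (trans r (sym p))

  onEdge-swap : ∀ {x y vs} → T (all (inEdge x y) vs) → T (all (inEdge y x) vs)
  onEdge-swap {x} {y} {vs} on = ⇒onEdge {y} {x} {vs} (Data.Sum.swap ∘ onEdge⇒ {x} {y} on)

  onSomeEdge-vertex : ∀ {vs u} → u ∈ vs → onSomeEdge vs ≡ onEdgeAt u vs
  onSomeEdge-vertex {vs} {u} u∈ = T-ext to from
    where
    to : T (onSomeEdge vs) → T (onEdgeAt u vs)
    to t with onSomeEdge⁻ vs t
    ... | x , y , adj-xy , on with onEdge⇒ {x} {y} on u∈
    ... | inj₁ refl = onEdgeAt⁺ {u} {vs} y adj-xy on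
    ... | inj₂ refl = onEdgeAt⁺ {u} {vs} x (subst T (adj-sym x u) adj-xy) (onEdge-swap {x} {u} {vs} on)

    from : T (onEdgeAt u vs) → T (onSomeEdge vs)
    from t with onEdgeAt⁻ u vs t
    ... | y , adj-uy , on = onSomeEdge⁺ {vs} u y adj-uy on

  onEdgeAt-· : ∀ π u → LocalIso adj π u → ∀ vs → onEdgeAt (π ⟨$⟩ʳ u) (map (π ⟨$⟩ʳ_) vs) ≡ onEdgeAt u vs
  onEdgeAt-· π u iso vs = T-ext to from
    where
    edge-· : ∀ y → (adj (π ⟨$⟩ʳ u) (π ⟨$⟩ʳ y) ∧ all (inEdge (π ⟨$⟩ʳ u) (π ⟨$⟩ʳ y)) (map (π ⟨$⟩ʳ_) vs))
                 ≡ (adj u y ∧ all (inEdge u y) vs)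
    edge-· y = cong₂ _∧_ (iso y) (all-inEdge-· π u y vs)

    to : T (onEdgeAt (π ⟨$⟩ʳ u) (map (π ⟨$⟩ʳ_) vs)) → T (onEdgeAt u vs)
    to t with onEdgeAt⁻ (π ⟨$⟩ʳ u) (map (π ⟨$⟩ʳ_) vs) t
    ... | y' , adj-πuy' , on = onEdgeAt⁺ {u} {vs} y (proj₁ edge-y) (proj₂ edge-y)
      where
      y : Fin n
      y = π ⟨$⟩ˡ y'
      edge-y : T (adj u y) × T (all (inEdge u y) vs)
      edge-y = Equivalence.to T-∧ (subst T (edge-· y)
        (subst (λ z → T (adj (π ⟨$⟩ʳ u) z ∧ all (inEdge (π ⟨$⟩ʳ u) z) (map (π ⟨$⟩ʳ_) vs))) (sym (inverseʳ π))
          (Equivalence.from T-∧ (adj-πuy' , on))))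

    from : T (onEdgeAt u vs) → T (onEdgeAt (π ⟨$⟩ʳ u) (map (π ⟨$⟩ʳ_) vs))
    from t with onEdgeAt⁻ u vs t
    ... | y , adj-uy , on = onEdgeAt⁺ {π ⟨$⟩ʳ u} {map (π ⟨$⟩ʳ_) vs} (π ⟨$⟩ʳ y)
      (proj₁ edge-πy) (proj₂ edge-πy)
      where
      edge-πy : T (adj (π ⟨$⟩ʳ u) (π ⟨$⟩ʳ y)) × T (all (inEdge (π ⟨$⟩ʳ u) (π ⟨$⟩ʳ y)) (map (π ⟨$⟩ʳ_) vs))
      edge-πy = Equivalence.to T-∧ (subst T (sym (edge-· y)) (Equivalence.from T-∧ (adj-uy , on)))

  FacePreserving : Permutation′ n → Cfg → Set
  FacePreserving π h = ∀ J → T (sub h J) → isFace (π · J) ≡ isFace J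

  isFace-· : ∀ π J → onSomeEdge (map (π ⟨$⟩ʳ_) (vals J)) ≡ onSomeEdge (vals J) → isFace (π · J) ≡ isFace J
  isFace-· π J onSomeEdge-· =
    cong₂ _∧_ (cong (_≤ᵇ suc H) (size-· π J)) (trans (cong onSomeEdge (values-relabel _ J)) onSomeEdge-·)

  facePreserving-edge : ∀ π h x y → x ∈ vals h → y ∈ vals h →
    T (adj x y) → T (adj (π ⟨$⟩ʳ x) (π ⟨$⟩ʳ y)) → FacePreserving π h
  facePreserving-edge π h x y x∈h y∈h adj-xy adj-πxπy J h⊆J = isFace-· π J (begin
    onSomeEdge (map (π ⟨$⟩ʳ_) (vals J))
      ≡⟨ onSomeEdge-edge (∈-map⁺ _ x∈J) (∈-map⁺ _ y∈J) adj-πxπy ⟩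
    all (inEdge (π ⟨$⟩ʳ x) (π ⟨$⟩ʳ y)) (map (π ⟨$⟩ʳ_) (vals J))
      ≡⟨ all-inEdge-· π x y (vals J) ⟩
    all (inEdge x y) (vals J)
      ≡⟨ sym (onSomeEdge-edge x∈J y∈J adj-xy) ⟩
    onSomeEdge (vals J) ∎)
    where
    open ≡-Reasoning
    x∈J : x ∈ vals J
    x∈J = sub-values h J h⊆J x∈h
    y∈J : y ∈ vals J
    y∈J = sub-values h J h⊆J y∈h

  facePreserving-vertex : ∀ π h u → u ∈ vals h → LocalIso adj π u → FacePreserving π h
  facePreserving-vertex π h u u∈h iso J h⊆J = isFace-· π J (begin
    onSomeEdge (map (π ⟨$⟩ʳ_) (vals J))
      ≡⟨ onSomeEdge-vertex (∈-map⁺ _ u∈J) ⟩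
    onEdgeAt (π ⟨$⟩ʳ u) (map (π ⟨$⟩ʳ_) (vals J))
      ≡⟨ onEdgeAt-· π u iso (vals J) ⟩
    onEdgeAt u (vals J)
      ≡⟨ sym (onSomeEdge-vertex u∈J) ⟩
    onSomeEdge (vals J) ∎)
    where
    open ≡-Reasoning
    u∈J : u ∈ vals J
    u∈J = sub-values h J h⊆J u∈h

  coface : Cfg → Cfg → Bool
  coface h J = isFace J ∧ (size J ≡ᵇ suc (size h)) ∧ sub h J

  coface-· : ∀ π h → FacePreserving π h → ∀ J → coface (π · h) (π · J) ≡ coface h J
  coface-· π h preserving J = begin
    isFace (π · J) ∧ (size (π · J) ≡ᵇ suc (size (π · h))) ∧ sub (π · h) (π · J)
      ≡⟨ cong₂ (λ d t → isFace (π · J) ∧ d ∧ t) (cong₂ _≡ᵇ_ (size-· π J) (cong suc (size-· π h))) (sub-· π h J) ⟩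
    isFace (π · J) ∧ (size J ≡ᵇ suc (size h)) ∧ sub h J
      ≡⟨ faces-above (sub h J) refl ⟩
    isFace J ∧ (size J ≡ᵇ suc (size h)) ∧ sub h J ∎
    where
    open ≡-Reasoning
    faces-above : ∀ t → sub h J ≡ t →
      isFace (π · J) ∧ (size J ≡ᵇ suc (size h)) ∧ t ≡ isFace J ∧ (size J ≡ᵇ suc (size h)) ∧ t
    faces-above true  h⊆J = cong (_∧ _) (preserving J (subst T (sym h⊆J) tt))
    faces-above false _ rewrite ∧-zeroʳ (size J ≡ᵇ suc (size h)) | ∧-zeroʳ (isFace J) = ∧-zeroʳ (isFace (π · J))

  -- the weight of h only depends on the faces above h
  wt-· : ∀ π m h → FacePreserving π h → wt m (π · h) ≡ wt m h
  wt-· π zero h _ = refl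
  wt-· π (suc m) h preserving =
    reindex sum sum-↭ (π ·_) (·-cfgs π) (coface h) (coface (π · h)) (wt m) (wt m)
      (coface-· π h preserving)
      (λ J h◃J → wt-· π m J (λ K J⊆K → preserving K (sub-trans h J K (h⊆J J h◃J) J⊆K)))
    where
    h⊆J : ∀ J → T (coface h J) → T (sub h J)
    h⊆J J h◃J = proj₂ (Equivalence.to (T-∧ {size J ≡ᵇ suc (size h)})
                 (proj₂ (Equivalence.to (T-∧ {isFace J}) h◃J)))

  w-· : ∀ π h → FacePreserving π h → w (π · h) ≡ w h
  w-· π h preserving rewrite size-· π h = wt-· π (suc H ∸ size h) h preserving

-- Labels of split states.  zeroOffset and validLabel inspect vals g by
-- 'with'; their list forms make them amenable to relabelling.
module Labels (n s H k deg : ℕ) (adj : Fin n → Fin n → Bool) where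
  open Chain n s H k deg adj
  open Action n s H k deg adj

  constant : List (Fin n) → Bool
  constant [] = true
  constant (u ∷ us) = all (eqF u) us

  labelFits : Bool → List (Fin n) → Fin n → Fin n → Bool
  labelFits true  []      x y = false
  labelFits true  (u ∷ _) x y = adj x y ∧ inEdge x y u
  labelFits false vs      x y = adj x y ∧ all (inEdge x y) vs ∧ any (eqF x) vs ∧ any (eqF y) vs

  zeroOffset≡constant : ∀ g → zeroOffset g ≡ constant (vals g)
  zeroOffset≡constant g with vals g
  ... | []     = refl
  ... | _ ∷ _  = refl

  validLabel≡labelFits : ∀ g x y → validLabel g x y ≡ labelFits (zeroOffset g) (vals g) x y
  validLabel≡labelFits g x y with vals g
  ... | []     = refl
  ... | u ∷ us with all (eqF u) us
  ...   | true  = refl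
  ...   | false = refl

  constant-· : ∀ π vs → constant (map (π ⟨$⟩ʳ_) vs) ≡ constant vs
  constant-· π [] = refl
  constant-· π (u ∷ us) = trans (all-map _ (π ⟨$⟩ʳ_) us) (all-cong (eqF-· π u) us)

  zeroOffset-· : ∀ π g → zeroOffset (π · g) ≡ zeroOffset g
  zeroOffset-· π g = begin
    zeroOffset (π · g)                ≡⟨ zeroOffset≡constant (π · g) ⟩
    constant (vals (π · g))           ≡⟨ cong constant (values-relabel _ g) ⟩
    constant (map (π ⟨$⟩ʳ_) (vals g)) ≡⟨ constant-· π (vals g) ⟩
    constant (vals g)                 ≡⟨ zeroOffset≡constant g ⟨
    zeroOffset g                      ∎
    where open ≡-Reasoning

  labelFits-· : ∀ π x y → adj (π ⟨$⟩ʳ x) (π ⟨$⟩ʳ y) ≡ adj x y →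
    ∀ t vs → labelFits t (map (π ⟨$⟩ʳ_) vs) (π ⟨$⟩ʳ x) (π ⟨$⟩ʳ y) ≡ labelFits t vs x y
  labelFits-· π x y adj-· true [] = refl
  labelFits-· π x y adj-· true (u ∷ _) = cong₂ _∧_ adj-· (inEdge-· π x y u)
  labelFits-· π x y adj-· false vs =
    cong₂ _∧_ adj-· (cong₂ _∧_ (all-inEdge-· π x y vs) (cong₂ _∧_ (uses x) (uses y)))
    where
    uses : ∀ z → any (eqF (π ⟨$⟩ʳ z)) (map (π ⟨$⟩ʳ_) vs) ≡ any (eqF z) vs
    uses z = trans (any-map _ (π ⟨$⟩ʳ_) vs) (any-cong (eqF-· π z) vs)

  validLabel-· : ∀ π x y → adj (π ⟨$⟩ʳ x) (π ⟨$⟩ʳ y) ≡ adj x y →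
    ∀ g → validLabel (π · g) (π ⟨$⟩ʳ x) (π ⟨$⟩ʳ y) ≡ validLabel g x y
  validLabel-· π x y adj-· g = begin
    validLabel (π · g) (π ⟨$⟩ʳ x) (π ⟨$⟩ʳ y)
      ≡⟨ validLabel≡labelFits (π · g) _ _ ⟩
    labelFits (zeroOffset (π · g)) (vals (π · g)) (π ⟨$⟩ʳ x) (π ⟨$⟩ʳ y)
      ≡⟨ cong₂ (λ t vs → labelFits t vs (π ⟨$⟩ʳ x) (π ⟨$⟩ʳ y)) (zeroOffset-· π g) (values-relabel _ g) ⟩
    labelFits (zeroOffset g) (map (π ⟨$⟩ʳ_) (vals g)) (π ⟨$⟩ʳ x) (π ⟨$⟩ʳ y)
      ≡⟨ labelFits-· π x y adj-· (zeroOffset g) (vals g) ⟩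
    labelFits (zeroOffset g) (vals g) x y
      ≡⟨ validLabel≡labelFits g x y ⟨
    validLabel g x y ∎
    where open ≡-Reasoning

  labelFits⇒onEdge : ∀ {x y} vs → T (labelFits (constant vs) vs x y) → ∀ {v} → v ∈ vs → v ≡ x ⊎ v ≡ y
  labelFits⇒onEdge [] ()
  labelFits⇒onEdge {x} {y} (u ∷ us) fits v∈ with constant (u ∷ us) in const
  ... | true  = subst (λ w → w ≡ x ⊎ w ≡ y) (same-as-head v∈) (inEdge⇒ (proj₂ (Equivalence.to (T-∧ {adj x y}) fits)))
    where
    same-as-head : ∀ {v} → v ∈ u ∷ us → u ≡ v
    same-as-head (here refl) = refl
    same-as-head (there v∈us) = eqF⇒ (All.lookup (AllP.all⁺ (eqF u) us (subst T (sym const) tt)) v∈us)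
  ... | false = onEdge⇒ {x} {y} {u ∷ us}
    (proj₁ (Equivalence.to T-∧ (proj₂ (Equivalence.to (T-∧ {adj x y}) fits)))) v∈

  validLabel⇒onEdge : ∀ g x y → T (validLabel g x y) → ∀ {v} → v ∈ vals g → v ≡ x ⊎ v ≡ y
  validLabel⇒onEdge g x y valid = labelFits⇒onEdge (vals g)
    (subst T (trans (validLabel≡labelFits g x y) (cong (λ t → labelFits t (vals g) x y) (zeroOffset≡constant g))) valid)

-- The isomorphism R_{o,ac} ≅ R_{o,σa σc}.  Besides σ it uses local
-- isomorphisms ψa at a and ψc at c that agree with σ there (see the header).
module RestrictionIso (n s H k deg : ℕ) (adj : Fin n → Fin n → Bool)
       (adj-sym : ∀ u v → adj u v ≡ adj v u) (loopless : ∀ v → adj v v ≡ false)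
       (a c : Fin n) (σ ψa ψc : Permutation′ n)
       (adj-ac : T (adj a c)) (adj-σaσc : T (adj (σ ⟨$⟩ʳ a) (σ ⟨$⟩ʳ c)))
       (ψa-a : ψa ⟨$⟩ʳ a ≡ σ ⟨$⟩ʳ a) (ψa-iso : LocalIso adj ψa a)
       (ψc-c : ψc ⟨$⟩ʳ c ≡ σ ⟨$⟩ʳ c) (ψc-iso : LocalIso adj ψc c) where
  open Chain n s H k deg adj
  open Action n s H k deg adj
  open Faces n s H k deg adj adj-sym loopless
  open Labels n s H k deg adj
  open import Data.List.Membership.DecPropositional (_≟_ {n}) using (_∈?_)

  a' c' : Fin n
  a' = σ ⟨$⟩ʳ a
  c' = σ ⟨$⟩ʳ c

  adj-σ : adj a' c' ≡ adj a c
  adj-σ = T-ext (λ _ → adj-ac) (λ _ → adj-σaσc)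

  OnEdge : Cfg → Set
  OnEdge h = ∀ {v} → v ∈ vals h → v ≡ a ⊎ v ≡ c

  faceRepresentative : ∀ h → OnEdge h → Σ (Permutation′ n) λ π → σ · h ≡ π · h × FacePreserving π h
  faceRepresentative h on with a ∈? vals h | c ∈? vals h
  ... | yes a∈ | yes c∈ = σ , refl , facePreserving-edge σ h a c a∈ c∈ adj-ac adj-σaσc
  ... | yes a∈ | no c∉ = ψa , relabel-local h (λ v∈ → σ≡ψa (on v∈) v∈) , facePreserving-vertex ψa h a a∈ ψa-iso
    where
    σ≡ψa : ∀ {v} → v ≡ a ⊎ v ≡ c → v ∈ vals h → σ ⟨$⟩ʳ v ≡ ψa ⟨$⟩ʳ v
    σ≡ψa (inj₁ refl) _  = sym ψa-a
    σ≡ψa (inj₂ refl) c∈ = ⊥-elim (c∉ c∈)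
  ... | no a∉ | yes c∈ = ψc , relabel-local h (λ v∈ → σ≡ψc (on v∈) v∈) , facePreserving-vertex ψc h c c∈ ψc-iso
    where
    σ≡ψc : ∀ {v} → v ≡ a ⊎ v ≡ c → v ∈ vals h → σ ⟨$⟩ʳ v ≡ ψc ⟨$⟩ʳ v
    σ≡ψc (inj₁ refl) a∈ = ⊥-elim (a∉ a∈)
    σ≡ψc (inj₂ refl) _  = sym ψc-c
  ... | no a∉ | no c∉ = idₚ , relabel-local h (λ v∈ → ⊥-elim (unused (on v∈) v∈)) ,
                         λ J _ → isFace-· idₚ J (cong onSomeEdge (ListP.map-id (vals J)))
    where
    unused : ∀ {v} → v ≡ a ⊎ v ≡ c → ¬ v ∈ vals h
    unused (inj₁ refl) = a∉
    unused (inj₂ refl) = c∉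

  w-σ : ∀ h → OnEdge h → w (σ · h) ≡ w h
  w-σ h on with faceRepresentative h on
  ... | π , σh≡πh , preserving = trans (cong w σh≡πh) (w-· π h preserving)

  isFace-σ : ∀ h → OnEdge h → isFace (σ · h) ≡ isFace h
  isFace-σ h on with faceRepresentative h on
  ... | π , σh≡πh , preserving = trans (cong isFace σh≡πh) (preserving h (lookup⇒sub h h (λ _ e → e)))

  erase-onEdge : ∀ h b → OnEdge h → OnEdge (remove h b)
  erase-onEdge h b on v∈ with values⇒lookup (remove h b) v∈
  ... | b' , e = on (lookup⇒values h b' (erase-lookup h b b' e))

  inΩ⇒onEdge : ∀ g → T (inΩ a c g) → OnEdge g
  inΩ⇒onEdge g t = validLabel⇒onEdge g a c (proj₂ (Equivalence.to (T-∧ {isKFace g}) t))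

  inΩ-σ : ∀ g → inΩ a' c' (σ · g) ≡ inΩ a c g
  inΩ-σ g = begin
    (isFace (σ · g) ∧ (size (σ · g) ≡ᵇ suc k)) ∧ validLabel (σ · g) a' c'
      ≡⟨ cong₂ (λ d t → (isFace (σ · g) ∧ d) ∧ t) (cong (_≡ᵇ suc k) (size-· σ g)) (validLabel-· σ a c adj-σ g) ⟩
    (isFace (σ · g) ∧ (size g ≡ᵇ suc k)) ∧ validLabel g a c
      ≡⟨ labelled (validLabel g a c) refl ⟩
    (isFace g ∧ (size g ≡ᵇ suc k)) ∧ validLabel g a c ∎
    where
    open ≡-Reasoning
    labelled : ∀ t → validLabel g a c ≡ t →
      (isFace (σ · g) ∧ (size g ≡ᵇ suc k)) ∧ t ≡ (isFace g ∧ (size g ≡ᵇ suc k)) ∧ t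
    labelled true valid =
      cong (λ f → (f ∧ (size g ≡ᵇ suc k)) ∧ true) (isFace-σ g (validLabel⇒onEdge g a c (subst T (sym valid) tt)))
    labelled false _ rewrite ∧-zeroʳ (isFace g ∧ (size g ≡ᵇ suc k)) = ∧-zeroʳ (isFace (σ · g) ∧ (size g ≡ᵇ suc k))

  removalTerm : Cfg → Cfg → Fin s → ℚ
  removalTerm g z b =
    if is-just (lookup g b) ∧ sub (remove g b) z then (1 ÷ℕ suc k) *ℚ (w z ÷ℕ w (remove g b)) else 0ℚ

  Q-σ : ∀ g z → OnEdge g → OnEdge z → Q (σ · g) (σ · z) ≡ Q g z
  Q-σ g z on-g on-z = cong sumℚ (ListP.map-cong term positions)
    where
    term : ∀ b → removalTerm (σ · g) (σ · z) b ≡ removalTerm g z b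
    term b = cong₂ (λ occupied val → if occupied then val else 0ℚ)
      (cong₂ _∧_ (trans (cong is-just (VecP.lookup-map b _ g)) (is-just-· σ (lookup g b)))
                 (trans (cong (λ r → sub r (σ · z)) (remove-· σ g b)) (sub-· σ (remove g b) z)))
      (cong₂ (λ wz wr → (1 ÷ℕ suc k) *ℚ (wz ÷ℕ wr)) (w-σ z on-z)
             (trans (cong w (remove-· σ g b)) (w-σ (remove g b) (erase-onEdge g b on-g))))

  P-σ : ∀ g z → OnEdge g → OnEdge z → P (σ · g) (σ · z) ≡ P g z
  P-σ g z on-g on-z = cong₂ (λ zo q → if zo then q *ℚ (1 ÷ℕ deg) else q) (zeroOffset-· σ z) (Q-σ g z on-g on-z)

  leaving : Fin n → Fin n → Cfg → ℚ
  leaving x y g = sumℚ (map (P g) (filterᵇ (λ z → inΩ x y z ∧ not (eqV g z)) cfgs))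

  leave-σ : ∀ g → OnEdge g → leaving a' c' (σ · g) ≡ leaving a c g
  leave-σ g on-g = reindex sumℚ sumℚ-↭ (σ ·_) (·-cfgs σ) _ _ (P (σ · g)) (P g)
    (λ z → cong₂ _∧_ (inΩ-σ z) (cong not (eqV-· σ g z)))
    (λ z t → P-σ g z on-g (inΩ⇒onEdge z (proj₁ (Equivalence.to (T-∧ {inΩ a c z}) t))))

  toΩ : Ω a c → Ω a' c'
  toΩ (g , t) = σ · g , subst T (sym (inΩ-σ g)) t

  fromΩ : Ω a' c' → Ω a c
  fromΩ (g , t) = g₀ , subst T (trans (cong (inΩ a' c') (sym (·-inverse' σ g))) (inΩ-σ g₀)) t
    where
    g₀ : Cfg
    g₀ = relabel (σ ⟨$⟩ˡ_) g

  Ω-≡ : ∀ {x y} {g g' : Cfg} {t : T (inΩ x y g)} {t' : T (inΩ x y g')} → g ≡ g' → _≡_ {A = Ω x y} (g , t) (g' , t')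
  Ω-≡ {t = t} {t'} refl = cong (_ ,_) (T-irrelevant t t')

  preserves : (x y : Ω a c) → R a' c' (toΩ x) (toΩ y) ≡ R a c x y
  preserves (g , t) (g' , t') = begin
    (if eqV (σ · g) (σ · g') then 1ℚ -ℚ leaving a' c' (σ · g) else P (σ · g) (σ · g'))
      ≡⟨ cong (λ same → if same then 1ℚ -ℚ leaving a' c' (σ · g) else P (σ · g) (σ · g')) (eqV-· σ g g') ⟩
    (if eqV g g' then 1ℚ -ℚ leaving a' c' (σ · g) else P (σ · g) (σ · g'))
      ≡⟨ cong₂ (λ stay move → if eqV g g' then stay else move)
               (cong (1ℚ -ℚ_) (leave-σ g on-g)) (P-σ g g' on-g (inΩ⇒onEdge g' t')) ⟩
    (if eqV g g' then 1ℚ -ℚ leaving a c g else P g g') ∎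
    where
    open ≡-Reasoning
    on-g : OnEdge g
    on-g = inΩ⇒onEdge g t

  restrictionIso : MarkovIso (R a c) (R a' c')
  restrictionIso = record
    { bij = mk↔ₛ′ toΩ fromΩ (λ { (g , _) → Ω-≡ (·-inverse' σ g) }) (λ { (g , _) → Ω-≡ (·-inverse σ g) })
    ; preserves = preserves
    }

mainTheorem5 : (H s k deg n : ℕ) (adj : Fin n → Fin n → Bool) →
  1 ≤ H → H + 1 ≤ s →
  SimpleGraph adj → Regular deg adj → TriangleFree adj →
  1 ≤ k → k < H →
  (a c a' c' : Fin n) → adj a c ≡ true → adj a' c' ≡ true →
  ¬ ((a ≡ a' × c ≡ c') ⊎ (a ≡ c' × c ≡ a')) →
  MarkovIso (Chain.R n s H k deg adj a c) (Chain.R n s H k deg adj a' c')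
mainTheorem5 H s k deg n adj _ _ (adj-sym , loopless) regular _ _ _ a c a' c' adj-ac adj-a'c' _
  with sending (a ∷ c ∷ []) (a' ∷ c' ∷ [])
         (edge-unique loopless (Equivalence.from T-≡ adj-ac))
         (edge-unique loopless (Equivalence.from T-≡ adj-a'c')) refl
... | σ , σa≡a' ∷ σc≡c' ∷ []
  with localIso loopless regular a (σ ⟨$⟩ʳ a) | localIso loopless regular c (σ ⟨$⟩ʳ c)
... | ψa , ψa-a , ψa-iso | ψc , ψc-c , ψc-iso =
  subst₂ (λ x y → MarkovIso (Chain.R n s H k deg adj a c) (Chain.R n s H k deg adj x y)) σa≡a' σc≡c'
    (RestrictionIso.restrictionIso n s H k deg adj adj-sym loopless a c σ ψa ψc
      (Equivalence.from T-≡ adj-ac)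
      (subst₂ (λ x y → T (adj x y)) (sym σa≡a') (sym σc≡c') (Equivalence.from T-≡ adj-a'c'))
      ψa-a ψa-iso ψc-c ψc-iso)
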